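{- Let $H$ be a connected, subcubic, triangle-free graph, and let $v\in V(H)$ be a vertex with $d(v)=2$ such that $H-v$ has a Hamiltonian cycle $v_1v_2\ldots v_{2p}$ (indices taken modulo $2p$). Let $v_i,v_j$, where $|i-j|\ge 2$, be the neighbors of $v$ on this cycle. If (1) one of the vertices $v_{i-1},v_{i+1},v_{j-1},v_{j+1}$ has degree $2$, or (2) there is a chord $v_{i-1}v_l$ of the cycle such that either $d(v_{l+1})=2$, or $d(v_{l-1})=2$ and $i-l$ is even, or (3) there is a chord $v_{i+1}v_l$ of the cycle such that either $d(v_{l-1})=2$, or $d(v_{l+1})=2$ and $i-l$ is even, then $\chi'(H)=3$.
   Context: All graphs are finite and simple; $d(u)$ is the degree of $u$ in $H$; subcubic means maximum degree at most $3$; $\chi'$ denotes the chromatic index; a chord of the cycle is an edge of $H-v$ joining two vertices not consecutive on the cycle. -}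

module Defs where

open import Data.Nat as ℕ using (ℕ; zero; suc)
open import Data.Bool using (Bool; true; false; if_then_else_)
open import Data.Fin using (Fin)
open import Data.List using (List; map; allFin)
open import Data.Nat.ListAction using (sum)
open import Data.Empty using (⊥)
open import Data.Integer as ℤ using (ℤ; +_; _-_; _+_; _*_; ∣_∣)
open import Data.Product using (Σ; _×_; ∃; ∃-syntax)
open import Relation.Binary.PropositionalEquality using (_≡_; _≢_)
open import Relation.Nullary using (¬_)

record Graph : Set where
  field
    n      : ℕ
    adj    : Fin n → Fin n → Bool
    sym    : ∀ u w → adj u w ≡ adj w u
    irrefl : ∀ u → adj u u ≡ false
open Graph public

E : (H : Graph) → Fin (n H) → Fin (n H) → Set
E H u w = adj H u w ≡ true

deg : (H : Graph) → Fin (n H) → ℕ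
deg H u = sum (map (λ w → if adj H u w then 1 else 0) (allFin (n H)))

Subcubic : Graph → Set
Subcubic H = ∀ u → deg H u ℕ.≤ 3

TriangleFree : Graph → Set
TriangleFree H = ∀ u w x → E H u w → E H w x → E H u x → ⊥

data Reach (H : Graph) : Fin (n H) → Fin (n H) → Set where
  here : ∀ {u} → Reach H u u
  step : ∀ {u w x} → E H u w → Reach H w x → Reach H u x

Connected : Graph → Set
Connected H = ∀ u w → Reach H u w

EdgeColorable : Graph → ℕ → Set
EdgeColorable H k =
  Σ (Fin (n H) → Fin (n H) → Fin k) λ col →
    (∀ u w → E H u w → col u w ≡ col w u) ×
    (∀ u w x → E H u w → E H u x → w ≢ x → col u w ≢ col u x)

ChromaticIndex : Graph → ℕ → Set
ChromaticIndex H k = EdgeColorable H k × (∀ m → m ℕ.< k → ¬ EdgeColorable H m)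

-- A Hamiltonian cycle of H - v of length m, given as a map c : ℤ → V(H)
-- periodic with period m (indices taken modulo m): v_k = c k.
HamCycleMinus : (H : Graph) → Fin (n H) → (m : ℕ) → (ℤ → Fin (n H)) → Set
HamCycleMinus H v m c =
  (3 ℕ.≤ m) ×
  (∀ k → c (k + + m) ≡ c k) ×
  (∀ a b → 0ℤ' ℤ.≤ a → a ℤ.< + m → 0ℤ' ℤ.≤ b → b ℤ.< + m → c a ≡ c b → a ≡ b) ×
  (∀ k → c k ≢ v) ×
  (∀ u → u ≢ v → ∃[ k ] c k ≡ u) ×
  (∀ k → E H (c k) (c (k + + 1)))
  where 0ℤ' = + 0

Chord : (H : Graph) → (ℤ → Fin (n H)) → ℤ → ℤ → Set
Chord H c a b = E H (c a) (c b) × c b ≢ c (a + + 1) × c b ≢ c (a - + 1)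

-- Walking from v once around the cycle, starting at v_i, gives a Hamiltonian path
-- v, v_i, v_(i+1), …, v_(i-1) of H whose last vertex is adjacent to v_i. In each case one
-- edge of this path can be traded for an edge at its last vertex v_(i-1): the cycle edge
-- v_(i-1) v_i in case (1), the chord in case (2). What remains is a spanning subgraph F that
-- is a path, or a path together with an even cycle, and whose vertices of degree one in F have
-- degree at most 2 in H. Colour F alternately with two colours; as H is subcubic, the other
-- edges form a matching and take the third colour. The remaining cases follow by walking the
-- other way round the cycle, or from v_j. Conversely v_i has three neighbours, so χ'(H) ≥ 3.

module Submission where

module EdgeColouring where

  open import Defs renaming (sym to adj-sym)
  open import Data.Bool using (Bool; true; false; if_then_else_)
  open import Data.Empty using (⊥-elim)
  open import Data.Fin using (Fin; zero; suc; inject₁; fromℕ)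
  open import Data.Fin.Properties using (_≟_; fromℕ≢inject₁; inject₁-injective)
  open import Data.List using ([]; _∷_; map; length; allFin)
  open import Data.List.Properties using (map-tabulate; length-map)
  open import Data.List.Relation.Unary.All using (All; []; _∷_; universal)
  import Data.List.Relation.Unary.All.Properties as All
  open import Data.List.Relation.Unary.AllPairs using ([]; _∷_)
  open import Data.List.Relation.Unary.Unique.Propositional using (Unique)
  open import Data.Nat as ℕ using (ℕ; zero; suc; _≤_; _<_; _∸_; z≤n; s≤s)
  open import Data.Nat.Divisibility using (_∣_; divides)
  open import Data.Nat.ListAction using (sum)
  open import Data.Nat.Properties
    using (+-suc; ≤⇒≯; _<?_; 1+n≢n; n<1+n; <⇒≤; <⇒≢; ≮⇒≥; ≤∧≢⇒<; ≤-antisym; ≤-refl; <-irrefl; <-asym;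
           <-trans; ≤-<-trans; ≤-pred; +-∸-assoc; m+n∸n≡m; suc-injective)
    renaming (_≟_ to _≟ℕ_)
  open import Data.Product using (∃; ∃-syntax; ∃₂; _×_; _,_; proj₁; proj₂)
  open import Data.Sum using (_⊎_; inj₁; inj₂; [_,_]′; swap)
  open import Function using (_∘_)
  open import Relation.Binary.PropositionalEquality
  open import Relation.Nullary using (¬_; Dec; yes; no; does; ¬?; _×-dec_; _⊎-dec_)
  open import Relation.Nullary.Decidable using (map′)

  module _ (H : Graph) where

    E-sym : ∀ {u w} → E H u w → E H w u
    E-sym {u} {w} u~w = trans (adj-sym H w u) u~w

    E-irrefl : ∀ {u} → ¬ E H u u
    E-irrefl {u} u~u with () ← trans (sym (irrefl H u)) u~u

  countTrue : ∀ {n} → (Fin n → Bool) → ℕ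
  countTrue {n} f = sum (map (λ w → if f w then 1 else 0) (allFin n))

  countTrue-suc : ∀ {n} (f : Fin (suc n) → Bool) →
                  countTrue f ≡ (if f zero then 1 else 0) ℕ.+ countTrue (f ∘ suc)
  countTrue-suc f = cong (λ ws → indicator zero ℕ.+ sum ws)
    (trans (map-tabulate suc indicator) (sym (map-tabulate (λ w → w) (indicator ∘ suc))))
    where
    indicator : Fin _ → ℕ
    indicator w = if f w then 1 else 0

  _without_ : ∀ {n} → (Fin n → Bool) → Fin n → Fin n → Bool
  (f without w) u = if does (u ≟ w) then false else f u

  countTrue-without : ∀ {n} (f : Fin n → Bool) w → f w ≡ true →
                      countTrue f ≡ suc (countTrue (f without w))
  countTrue-without {suc n} f zero fw
    rewrite countTrue-suc f | countTrue-suc (f without zero) | fw = refl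
  countTrue-without {suc n} f (suc w) fw
    rewrite countTrue-suc f | countTrue-suc (f without suc w)
          | countTrue-without (f ∘ suc) w fw = +-suc _ _

  without-≢ : ∀ {n} (f : Fin n → Bool) {w u} → w ≢ u → (f without w) u ≡ f u
  without-≢ f {w} {u} w≢u with u ≟ w
  ... | yes refl = ⊥-elim (w≢u refl)
  ... | no _ = refl

  length≤countTrue : ∀ {n} (f : Fin n → Bool) {ws} → Unique ws →
                     All (λ w → f w ≡ true) ws → length ws ≤ countTrue f
  length≤countTrue f [] [] = z≤n
  length≤countTrue f {w ∷ ws} (w∉ws ∷ unique) (fw ∷ all-true) =
    subst (suc (length ws) ≤_) (sym (countTrue-without f w fw))
      (s≤s (length≤countTrue (f without w) unique (still-true w∉ws all-true)))
    where
    still-true : ∀ {us} → All (w ≢_) us → All (λ u → f u ≡ true) us →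
                 All (λ u → (f without w) u ≡ true) us
    still-true [] [] = []
    still-true (w≢u ∷ w≢us) (fu ∷ fus) = trans (without-≢ f w≢u) fu ∷ still-true w≢us fus

  length≤deg : ∀ (H : Graph) {u ws} → Unique ws → All (E H u) ws → length ws ≤ deg H u
  length≤deg H {u} = length≤countTrue (adj H u)

  countTrue-true : ∀ k → countTrue {k} (λ _ → true) ≡ k
  countTrue-true zero = refl
  countTrue-true (suc k) = trans (countTrue-suc {k} (λ _ → true)) (cong suc (countTrue-true k))

  length≤colours : ∀ (H : Graph) {k u ws} → EdgeColorable H k → Unique ws → All (E H u) ws → length ws ≤ k
  length≤colours H {k} {u} {ws} (col , _ , proper) unique u~ws =
    subst₂ _≤_ (length-map (col u) ws) (countTrue-true k)
      (length≤countTrue (λ _ → true) (colours-distinct unique u~ws) (universal (λ _ → refl) _))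
    where
    colours-distinct : ∀ {ws} → Unique ws → All (E H u) ws → Unique (map (col u) ws)
    colours-distinct [] [] = []
    colours-distinct {w ∷ _} (w∉ws ∷ unique) (u~w ∷ u~ws) =
      All.map⁺ (differ w∉ws u~ws) ∷ colours-distinct unique u~ws
      where
      differ : ∀ {vs} → All (w ≢_) vs → All (E H u) vs → All (λ w′ → col u w ≢ col u w′) vs
      differ [] [] = []
      differ (w≢w′ ∷ w≢vs) (u~w′ ∷ u~vs) = proper u _ _ u~w u~w′ w≢w′ ∷ differ w≢vs u~vs

  module _ (H : Graph) {k : ℕ}
    (F : Fin (n H) → Fin (n H) → Set) (F? : ∀ u w → Dec (F u w))
    (F-sym : ∀ {u w} → F u w → F w u)
    (col : ∀ {u w} → F u w → Fin k)
    (col-sym : ∀ {u w} (f : F u w) (g : F w u) → col f ≡ col g)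
    (col-proper : ∀ {u w x} (f : F u w) (g : F u x) → w ≢ x → col f ≢ col g)
    (outside-matching : ∀ {u w x} → E H u w → E H u x → ¬ F u w → ¬ F u x → w ≡ x)
    where

    private
      colour : ∀ {u w} → Dec (F u w) → Fin (suc k)
      colour (yes f) = inject₁ (col f)
      colour (no _) = fromℕ k

      colour-sym : ∀ {u w} (d : Dec (F u w)) (d˘ : Dec (F w u)) → colour d ≡ colour d˘
      colour-sym (yes f) (yes g) = cong inject₁ (col-sym f g)
      colour-sym (yes f) (no ¬g) = ⊥-elim (¬g (F-sym f))
      colour-sym (no ¬f) (yes g) = ⊥-elim (¬f (F-sym g))
      colour-sym (no _) (no _) = refl

      colour-proper : ∀ u w x → E H u w → E H u x → w ≢ x → colour (F? u w) ≢ colour (F? u x)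
      colour-proper u w x u~w u~x w≢x with F? u w | F? u x
      ... | yes f | yes g = col-proper f g w≢x ∘ inject₁-injective
      ... | yes _ | no _ = fromℕ≢inject₁ ∘ sym
      ... | no _ | yes _ = fromℕ≢inject₁
      ... | no ¬f | no ¬g = λ _ → w≢x (outside-matching u~w u~x ¬f ¬g)

    edgeColorable-suc : EdgeColorable H (suc k)
    edgeColorable-suc = (λ u w → colour (F? u w)) , (λ u w _ → colour-sym (F? u w) (F? w u)) , colour-proper

  record Enumeration (H : Graph) : Set where
    field
      last : ℕ
      vertexAt : ℕ → Fin (n H)
      vertexAt-injective : ∀ {a b} → a ≤ last → b ≤ last → vertexAt a ≡ vertexAt b → a ≡ b
      vertexAt-surjective : ∀ u → ∃[ a ] (a ≤ last × vertexAt a ≡ u)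

    index : Fin (n H) → ℕ
    index u = proj₁ (vertexAt-surjective u)

    index≤last : ∀ u → index u ≤ last
    index≤last u = proj₁ (proj₂ (vertexAt-surjective u))

    vertexAt-index : ∀ u → vertexAt (index u) ≡ u
    vertexAt-index u = proj₂ (proj₂ (vertexAt-surjective u))

    index-vertexAt : ∀ {a} → a ≤ last → index (vertexAt a) ≡ a
    index-vertexAt {a} a≤last =
      vertexAt-injective (index≤last (vertexAt a)) a≤last (vertexAt-index (vertexAt a))

    module _ (F : ℕ → ℕ → Set) where

      Neighbour : ℕ → ℕ → Set
      Neighbour a b = b ≤ last × E H (vertexAt a) (vertexAt b) × F a b

      -- In a subcubic graph this leaves at most one edge at vertexAt a outside F.
      Saturated : ℕ → Set
      Saturated a = (deg H (vertexAt a) ≤ 2 × ∃ (Neighbour a))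
                  ⊎ (∃₂ λ b b′ → b ≢ b′ × Neighbour a b × Neighbour a b′)

      saturated⇒edgeColorable :
        Subcubic H → (∀ a b → Dec (F a b)) → (∀ {a b} → F a b → F b a) →
        {k : ℕ} (col : ∀ {a b} → F a b → Fin k) →
        (∀ {a b} (f : F a b) (g : F b a) → col f ≡ col g) →
        (∀ {a b b′} (f : F a b) (g : F a b′) → b ≢ b′ → col f ≢ col g) →
        (∀ a → a ≤ last → Saturated a) → EdgeColorable H (suc k)
      saturated⇒edgeColorable subcubic F? F-sym col col-sym col-proper saturated =
        edgeColorable-suc H (λ u w → F (index u) (index w)) (λ u w → F? (index u) (index w))
          F-sym col col-sym (λ f g w≢x → col-proper f g (w≢x ∘ index-injective)) outside-matching
        where
        index-injective : ∀ {w x} → index w ≡ index x → w ≡ x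
        index-injective {w} {x} eq =
          trans (sym (vertexAt-index w)) (trans (cong vertexAt eq) (vertexAt-index x))

        adjacent : ∀ {u b} → Neighbour (index u) b → E H u (vertexAt b)
        adjacent {u} (_ , u~b , _) = subst (λ z → E H z _) (vertexAt-index u) u~b

        outside : ∀ {u b w} → Neighbour (index u) b → ¬ F (index u) (index w) → w ≢ vertexAt b
        outside (b≤last , _ , Fb) ¬Fw refl = ¬Fw (subst (F _) (sym (index-vertexAt b≤last)) Fb)

        outside-matching : ∀ {u w x} → E H u w → E H u x →
                           ¬ F (index u) (index w) → ¬ F (index u) (index x) → w ≡ x
        outside-matching {u} {w} {x} u~w u~x ¬Fw ¬Fx with w ≟ x | saturated (index u) (index≤last u)
        ... | yes w≡x | _ = w≡x
        ... | no w≢x | inj₁ (deg≤2 , b , nb) =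
          ⊥-elim (≤⇒≯ (subst (λ z → deg H z ≤ 2) (vertexAt-index u) deg≤2)
            (length≤deg H ((w≢x ∷ outside nb ¬Fw ∷ []) ∷ (outside nb ¬Fx ∷ []) ∷ [] ∷ [])
                          (u~w ∷ u~x ∷ adjacent nb ∷ [])))
        ... | no w≢x | inj₂ (b , b′ , b≢b′ , nb , nb′) =
          ⊥-elim (≤⇒≯ (subcubic u)
            (length≤deg H ((w≢x ∷ outside nb ¬Fw ∷ outside nb′ ¬Fw ∷ [])
                           ∷ (outside nb ¬Fx ∷ outside nb′ ¬Fx ∷ [])
                           ∷ (b≢b′ ∘ vertexAt-injective (proj₁ nb) (proj₁ nb′) ∷ []) ∷ [] ∷ [])
                          (u~w ∷ u~x ∷ adjacent nb ∷ adjacent nb′ ∷ [])))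

  parity : ℕ → Fin 2
  parity zero = zero
  parity (suc zero) = suc zero
  parity (suc (suc n)) = parity n

  parity-suc : ∀ n → parity (suc n) ≢ parity n
  parity-suc zero ()
  parity-suc (suc zero) ()
  parity-suc (suc (suc n)) = parity-suc n

  parity-∸-suc : ∀ {m n} → m < n → parity (n ∸ suc m) ≢ parity (n ∸ m)
  parity-∸-suc {m} {suc n} (s≤s m≤n) rewrite +-∸-assoc 1 m≤n = ≢-sym (parity-suc (n ∸ m))

  parity-suc-∸ : ∀ n → parity (suc n ∸ n) ≡ suc zero
  parity-suc-∸ n = cong parity (m+n∸n≡m 1 n)

  parity-1+*2 : ∀ q → parity (suc (q ℕ.* 2)) ≡ suc zero
  parity-1+*2 zero = refl
  parity-1+*2 (suc q) = parity-1+*2 q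

  2∣1+n⇒parity≡1 : ∀ {n} → 2 ∣ suc n → parity n ≡ suc zero
  2∣1+n⇒parity≡1 (divides (suc q) eq) rewrite suc-injective eq = parity-1+*2 q

  -- Exchange L x y z: the path edge {y, y + 1} = {x, z} is traded for the chord {x, L}.
  -- Trading the edge after x leaves a Hamiltonian path; trading the edge before x splits
  -- off the cycle x, …, L, which must have even length L ∸ y.
  data Exchange (L : ℕ) : ℕ → ℕ → ℕ → Set where
    after  : ∀ {x} → Exchange L (suc x) (suc x) (suc (suc x))
    before : ∀ {y} → y ≢ 0 → 2 ∣ (L ∸ y) → Exchange L (suc y) y y

  exchange-endpoint : ∀ {L x y z t} → Exchange L x y z → t ≢ y → suc t ≢ y → suc t ≢ x
  exchange-endpoint after _ t+1≢y = t+1≢y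
  exchange-endpoint (before _ _) t≢y _ = t≢y ∘ suc-injective

  exchange-avoids : ∀ {L x y z a} → Exchange L x y z → a ≢ x → a ≢ z → a ≢ y × a ≢ suc y
  exchange-avoids after a≢x a≢z = a≢x , a≢z
  exchange-avoids (before _ _) a≢x a≢z = a≢z , a≢x

  exchange-odd : ∀ {L x y z} → Exchange L x y z → x < L → x ≢ y → parity (L ∸ x) ≡ suc zero
  exchange-odd after _ x≢y = ⊥-elim (x≢y refl)
  exchange-odd (before {zero} y≢0 _) _ _ = ⊥-elim (y≢0 refl)
  exchange-odd {suc L} (before {suc y} _ even) (s≤s x≤L) _
    rewrite +-∸-assoc 1 (<⇒≤ x≤L) = 2∣1+n⇒parity≡1 even

  module ExchangeColouring {H : Graph} (en : Enumeration H) where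
    open Enumeration en

    data Step (x y : ℕ) : ℕ → ℕ → Set where
      path  : ∀ {t} → t < last → t ≢ y → Step x y t (suc t)
      chord : ∀ {b} → suc x < last → b ≡ last → Step x y x b

    Link : ℕ → ℕ → ℕ → ℕ → Set
    Link x y a b = Step x y a b ⊎ Step x y b a

    private
      Step-fields : ℕ → ℕ → ℕ → ℕ → Set
      Step-fields x y a b = (b ≡ suc a × a < last × a ≢ y) ⊎ (a ≡ x × suc x < last × b ≡ last)

      fromFields : ∀ {x y a b} → Step-fields x y a b → Step x y a b
      fromFields (inj₁ (refl , a<last , a≢y)) = path a<last a≢y
      fromFields (inj₂ (refl , x<last , b≡last)) = chord x<last b≡last

      toFields : ∀ {x y a b} → Step x y a b → Step-fields x y a b
      toFields (path a<last a≢y) = inj₁ (refl , a<last , a≢y)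
      toFields (chord x<last b≡last) = inj₂ (refl , x<last , b≡last)

    step? : ∀ {x y} a b → Dec (Step x y a b)
    step? {x} {y} a b = map′ fromFields toFields
      ((b ≟ℕ suc a ×-dec a <? last ×-dec ¬? (a ≟ℕ y)) ⊎-dec (a ≟ℕ x ×-dec suc x <? last ×-dec b ≟ℕ last))

    link? : ∀ {x y} a b → Dec (Link x y a b)
    link? a b = step? a b ⊎-dec step? b a

    step-< : ∀ {x y a b} → Step x y a b → a < b
    step-< (path _ _) = n<1+n _
    step-< {x} (chord x<last refl) = <-trans (n<1+n x) x<last

    -- Path edges are coloured alternately, counting back from x below x and from last above it,
    -- so that both edges ending at a chord endpoint get colour 1; the chord gets colour 0.
    pathColour : ℕ → ℕ → Fin 2
    pathColour x t with t <? x
    ... | yes _ = parity (x ∸ t)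
    ... | no _ = parity (last ∸ t)

    stepColour : ∀ {x y a b} → Step x y a b → Fin 2
    stepColour {x} (path {t} _ _) = pathColour x t
    stepColour (chord _ _) = zero

    linkColour : ∀ {x y a b} → Link x y a b → Fin 2
    linkColour = [ stepColour , stepColour ]′

    pathColour-into-x : ∀ t → pathColour (suc t) t ≡ suc zero
    pathColour-into-x t with t <? suc t
    ... | yes _ = parity-suc-∸ t
    ... | no t≮1+t = ⊥-elim (t≮1+t (n<1+n t))

    pathColour-into-last : ∀ {x t} → suc x < last → suc t ≡ last → pathColour x t ≡ suc zero
    pathColour-into-last {x} {t} x+1<last t+1≡last with t <? x
    ... | yes t<x = ⊥-elim (<-asym t<x (≤-pred (subst (suc (suc x) ≤_) (sym t+1≡last) x+1<last)))
    ... | no _ = subst (λ l → parity (l ∸ t) ≡ suc zero) t+1≡last (parity-suc-∸ t)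

    pathColour-from-x : ∀ x → parity (last ∸ x) ≡ suc zero → pathColour x x ≡ suc zero
    pathColour-from-x x odd with x <? x
    ... | yes x<x = ⊥-elim (<-irrefl refl x<x)
    ... | no _ = odd

    pathColour-alternates : ∀ {x t} → suc t < last → suc t ≢ x → pathColour x (suc t) ≢ pathColour x t
    pathColour-alternates {x} {t} t+1<last t+1≢x with suc t <? x | t <? x
    ... | yes _ | yes t<x = parity-∸-suc t<x
    ... | yes t+1<x | no t≮x = ⊥-elim (t≮x (<-trans (n<1+n t) t+1<x))
    ... | no t+1≮x | yes t<x = ⊥-elim (t+1≢x (≤-antisym t<x (≮⇒≥ t+1≮x)))
    ... | no _ | no _ = parity-∸-suc (<-trans (n<1+n t) t+1<last)

    private
      one≢zero : ∀ {c : Fin 2} → c ≡ suc zero → c ≢ zero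
      one≢zero refl ()

    stepColour-irrelevant : ∀ {x y a b} (s s′ : Step x y a b) → stepColour s ≡ stepColour s′
    stepColour-irrelevant (path _ _) (path _ _) = refl
    stepColour-irrelevant (path _ _) (chord x+1<last x+1≡last) = ⊥-elim (<-irrefl x+1≡last x+1<last)
    stepColour-irrelevant (chord x+1<last x+1≡last) (path _ _) = ⊥-elim (<-irrefl x+1≡last x+1<last)
    stepColour-irrelevant (chord _ _) (chord _ _) = refl

    linkColour-sym : ∀ {x y a b} (f : Link x y a b) (g : Link x y b a) → linkColour f ≡ linkColour g
    linkColour-sym (inj₁ s) (inj₂ s′) = stepColour-irrelevant s s′
    linkColour-sym (inj₂ s) (inj₁ s′) = stepColour-irrelevant s s′
    linkColour-sym (inj₁ s) (inj₁ s′) = ⊥-elim (<-asym (step-< s) (step-< s′))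
    linkColour-sym (inj₂ s) (inj₂ s′) = ⊥-elim (<-asym (step-< s) (step-< s′))

    module _ {x y z : ℕ} (exchange : Exchange last x y z) where

      leaving-x≢chord : x ≢ y → suc x < last → pathColour x x ≢ zero
      leaving-x≢chord x≢y x+1<last =
        one≢zero (pathColour-from-x x (exchange-odd exchange (<-trans (n<1+n x) x+1<last) x≢y))

      stepColour-out-out : ∀ {a b b′} (f : Step x y a b) (g : Step x y a b′) → b ≢ b′ →
                           stepColour f ≢ stepColour g
      stepColour-out-out (path _ _) (path _ _) b≢b′ = ⊥-elim (b≢b′ refl)
      stepColour-out-out (path _ x≢y) (chord x+1<last _) _ = leaving-x≢chord x≢y x+1<last
      stepColour-out-out (chord x+1<last _) (path _ x≢y) _ = ≢-sym (leaving-x≢chord x≢y x+1<last)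
      stepColour-out-out (chord _ refl) (chord _ refl) b≢b′ = ⊥-elim (b≢b′ refl)

      stepColour-in-in : ∀ {a b b′} (f : Step x y b a) (g : Step x y b′ a) → b ≢ b′ →
                         stepColour f ≢ stepColour g
      stepColour-in-in (path _ _) (path _ _) b≢b′ = ⊥-elim (b≢b′ refl)
      stepColour-in-in (path _ _) (chord x+1<last t+1≡last) _ =
        one≢zero (pathColour-into-last x+1<last t+1≡last)
      stepColour-in-in (chord x+1<last t+1≡last) (path _ _) _ =
        ≢-sym (one≢zero (pathColour-into-last x+1<last t+1≡last))
      stepColour-in-in (chord _ _) (chord _ _) b≢b′ = ⊥-elim (b≢b′ refl)

      stepColour-out-in : ∀ {a b b′} (f : Step x y a b) (g : Step x y b′ a) → b ≢ b′ →
                          stepColour f ≢ stepColour g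
      stepColour-out-in (path t+1<last t+1≢y) (path _ t≢y) _ =
        pathColour-alternates t+1<last (exchange-endpoint exchange t≢y t+1≢y)
      stepColour-out-in (path a<last _) (chord _ a≡last) _ = ⊥-elim (<-irrefl a≡last a<last)
      stepColour-out-in (chord _ _) (path {t} _ _) _ = ≢-sym (one≢zero (pathColour-into-x t))
      stepColour-out-in (chord x+1<last _) (chord _ x≡last) _ =
        ⊥-elim (<-irrefl x≡last (<-trans (n<1+n x) x+1<last))

      linkColour-proper : ∀ {a b b′} (f : Link x y a b) (g : Link x y a b′) → b ≢ b′ →
                          linkColour f ≢ linkColour g
      linkColour-proper (inj₁ f) (inj₁ g) = stepColour-out-out f g
      linkColour-proper (inj₂ f) (inj₂ g) = stepColour-in-in f g
      linkColour-proper (inj₁ f) (inj₂ g) = stepColour-out-in f g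
      linkColour-proper (inj₂ f) (inj₁ g) b≢b′ = ≢-sym (stepColour-out-in g f (≢-sym b≢b′))

    module _ (adjacent : ∀ {t} → t < last → E H (vertexAt t) (vertexAt (suc t))) {x y : ℕ} where

      forward : ∀ {t} → t < last → t ≢ y → Neighbour (Link x y) t (suc t)
      forward t<last t≢y = t<last , adjacent t<last , inj₁ (path t<last t≢y)

      backward : ∀ {t} → t < last → t ≢ y → Neighbour (Link x y) (suc t) t
      backward t<last t≢y = <⇒≤ t<last , E-sym H (adjacent t<last) , inj₂ (path t<last t≢y)

      module _ (x+1<last : suc x < last) (x~last : E H (vertexAt x) (vertexAt last)) where

        x<last : x < last
        x<last = <-trans (n<1+n x) x+1<last

        chord-forward : Neighbour (Link x y) x last
        chord-forward = ≤-refl , x~last , inj₁ (chord x+1<last refl)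

        chord-backward : ∀ {a} → a ≡ last → Neighbour (Link x y) a x
        chord-backward refl = <⇒≤ x<last , E-sym H x~last , inj₂ (chord x+1<last refl)

        saturated-elsewhere : deg H (vertexAt 0) ≤ 2 → ∀ {a} → a ≤ last → a ≢ y × a ≢ suc y →
                              Saturated (Link x y) a
        saturated-elsewhere deg-first {zero} _ (0≢y , _) =
          inj₁ (deg-first , 1 , forward (≤-<-trans z≤n x<last) 0≢y)
        saturated-elsewhere _ {suc a} a+1≤last (a+1≢y , a+1≢y+1) with suc a ≟ℕ last
        ... | yes a+1≡last =
          inj₂ (a , x , a≢x , backward a+1≤last (a+1≢y+1 ∘ cong suc) , chord-backward a+1≡last)
          where
          a≢x : a ≢ x
          a≢x refl = <-irrefl a+1≡last x+1<last
        ... | no a+1≢last =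
          inj₂ (a , suc (suc a) , <⇒≢ (<-trans (n<1+n a) (n<1+n (suc a))) ,
                backward a+1≤last (a+1≢y+1 ∘ cong suc) , forward (≤∧≢⇒< a+1≤last a+1≢last) a+1≢y)

        saturated-at-x : ∀ {z} → Exchange last x y z → Saturated (Link x y) x
        saturated-at-x (after {x′}) =
          inj₂ (x′ , last , <⇒≢ x′<last , backward x′<last (≢-sym 1+n≢n) , chord-forward)
          where
          x′<last : x′ < last
          x′<last = <-trans (n<1+n x′) x<last
        saturated-at-x (before _ _) =
          inj₂ (suc x , last , <⇒≢ x+1<last , forward x<last 1+n≢n , chord-forward)

        saturated-at-z : ∀ {z} → Exchange last x y z → deg H (vertexAt z) ≤ 2 → Saturated (Link x y) z
        saturated-at-z after deg-z = inj₁ (deg-z , _ , forward x+1<last 1+n≢n)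
        saturated-at-z (before {zero} y≢0 _) _ = ⊥-elim (y≢0 refl)
        saturated-at-z (before {suc y′} _ _) deg-z =
          inj₁ (deg-z , y′ , backward (<-trans (n<1+n y′) (<-trans (n<1+n (suc y′)) x<last)) (≢-sym 1+n≢n))

        saturated : deg H (vertexAt 0) ≤ 2 → ∀ {z} → Exchange last x y z → deg H (vertexAt z) ≤ 2 →
                    ∀ a → a ≤ last → Saturated (Link x y) a
        saturated deg-first {z} exchange deg-z a a≤last with a ≟ℕ x | a ≟ℕ z
        ... | yes refl | _ = saturated-at-x exchange
        ... | no _ | yes refl = saturated-at-z exchange deg-z
        ... | no a≢x | no a≢z = saturated-elsewhere deg-first a≤last (exchange-avoids exchange a≢x a≢z)

    exchange⇒edgeColorable : Subcubic H → (∀ {t} → t < last → E H (vertexAt t) (vertexAt (suc t))) →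
      deg H (vertexAt 0) ≤ 2 → ∀ {x y z} → Exchange last x y z → suc x < last →
      E H (vertexAt x) (vertexAt last) → deg H (vertexAt z) ≤ 2 → EdgeColorable H 3
    exchange⇒edgeColorable subcubic adjacent deg-first {x} {y} exchange x+1<last x~last deg-z =
      saturated⇒edgeColorable (Link x y) subcubic link? swap linkColour linkColour-sym
        (linkColour-proper exchange) (saturated adjacent x+1<last x~last deg-first exchange deg-z)

module HamiltonianCycle where

  open import Defs hiding (sym)
  open import Data.Empty using (⊥-elim)
  open import Data.Fin using (Fin)
  open import Data.Fin.Properties using (_≟_)
  open import Data.Integer as ℤ
    using (ℤ; +_; +[1+_]; -[1+_]; -_; _+_; _-_; _*_; _%ℕ_; _/ℕ_; ∣_∣; +≤+; +<+)
  open import Data.Integer.DivMod using (a≡a%ℕn+[a/ℕn]*n; n%ℕd<d)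
  open import Data.Integer.Divisibility.Signed as Signed using (∣ᵤ⇒∣; ∣⇒∣ᵤ; ∣m+n∣n⇒∣m; ∣n⇒∣m*n; ∣m⇒∣-m)
  open import Data.Integer.Properties using (+-identityʳ; +-assoc; +-injective; neg-involutive; pos-*; ∣-i∣≡∣i∣)
  open import Data.Integer.Tactic.RingSolver using (solve-∀)
  open import Data.List.Relation.Unary.All using ([]; _∷_)
  open import Data.List.Relation.Unary.AllPairs using ([]; _∷_)
  open import Data.Nat as ℕ using (ℕ; zero; suc; _≤_; _<_; _∸_; z≤n; s≤s)
  open import Data.Nat.Divisibility using (_∣_; ∣m+n∣m⇒∣n)
  open import Data.Nat.Properties
    using (≤⇒≯; m≤m+n; m≤n+m; ≤-trans; ≤-refl; ≤-reflexive; ≤-pred; <⇒≤; ≤∧≢⇒<; <-irrefl; m+[n∸m]≡n)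
  open import Data.Product using (∃-syntax; ∃₂; _×_; _,_; proj₁; proj₂)
  open import Data.Sum using (_⊎_; inj₁; inj₂)
  open import Function using (_∘_)
  open import Relation.Binary.PropositionalEquality
  open import Relation.Nullary using (yes; no)
  open EdgeColouring using (E-sym; E-irrefl; length≤colours; Enumeration; after; before)
  open EdgeColouring.ExchangeColouring using (exchange⇒edgeColorable)

  module _ {A : Set} {m : ℕ} (f : ℤ → A) (periodic : ∀ k → f (k + + m) ≡ f k) where

    periodic-+ : ∀ k q → f (k + + q * + m) ≡ f k
    periodic-+ k zero = cong f (+-identityʳ k)
    periodic-+ k (suc q) =
      trans (cong f (shift k (+ q) (+ m))) (trans (periodic _) (periodic-+ k q))
      where
      shift : ∀ k q m → k + (+ 1 + q) * m ≡ (k + q * m) + m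
      shift = solve-∀

    periodic-multiple : ∀ k q → f (k + q * + m) ≡ f k
    periodic-multiple k (+ q) = periodic-+ k q
    periodic-multiple k -[1+ q ] =
      trans (sym (periodic-+ (k + -[1+ q ] * + m) (suc q))) (cong f (cancel k (+ suc q) (+ m)))
      where
      cancel : ∀ k q m → (k + (- q) * m) + q * m ≡ k
      cancel = solve-∀

  no-positive-multiple : ∀ {m s t} q → s < m → + s ≢ + t + + suc q * + m
  no-positive-multiple {m} {s} {t} q s<m eq =
    ≤⇒≯ (≤-trans (m≤m+n m (q ℕ.* m)) (≤-trans (m≤n+m _ t) (≤-reflexive (sym s≡t+[q+1]m)))) s<m
    where
    s≡t+[q+1]m : s ≡ t ℕ.+ suc q ℕ.* m
    s≡t+[q+1]m = +-injective (trans eq (cong (λ z → + t + z) (sym (pos-* (suc q) m))))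

  residue-unique : ∀ {m s t} q → s < m → t < m → + s ≡ + t + q * + m → s ≡ t
  residue-unique (+ zero) _ _ eq = +-injective (trans eq (+-identityʳ _))
  residue-unique +[1+ q ] s<m _ eq = ⊥-elim (no-positive-multiple q s<m eq)
  residue-unique {m} {s} {t} -[1+ q ] _ t<m eq =
    ⊥-elim (no-positive-multiple q t<m (trans (flip (+ t) (+ suc q) (+ m)) (cong (λ z → z + + suc q * + m) (sym eq))))
    where
    flip : ∀ t q m → t ≡ (t + (- q) * m) + q * m
    flip = solve-∀

  cancel-left : ∀ i {a b x} → i + a ≡ (i + b) + x → a ≡ b + x
  cancel-left i {a} {b} {x} eq = trans (add-sub i a) (trans (cong (_- i) eq) (sub-add i b x))
    where
    add-sub : ∀ i a → a ≡ (i + a) - i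
    add-sub = solve-∀
    sub-add : ∀ i b x → ((i + b) + x) - i ≡ b + x
    sub-add = solve-∀

  module HamCycle (H : Graph) {v : Fin (n H)} {ℓ : ℕ} (c : ℤ → Fin (n H))
                  (ham : HamCycleMinus H v (suc ℓ) c) where

    three≤length : 3 ≤ suc ℓ
    three≤length = proj₁ ham

    periodic : ∀ k → c (k + + suc ℓ) ≡ c k
    periodic = proj₁ (proj₂ ham)

    injective-on-period : ∀ a b → + 0 ℤ.≤ a → a ℤ.< + suc ℓ → + 0 ℤ.≤ b → b ℤ.< + suc ℓ → c a ≡ c b → a ≡ b
    injective-on-period = proj₁ (proj₂ (proj₂ ham))

    avoids : ∀ k → c k ≢ v
    avoids = proj₁ (proj₂ (proj₂ (proj₂ ham)))

    covers : ∀ u → u ≢ v → ∃[ k ] c k ≡ u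
    covers = proj₁ (proj₂ (proj₂ (proj₂ (proj₂ ham))))

    adjacent : ∀ k → E H (c k) (c (k + + 1))
    adjacent = proj₂ (proj₂ (proj₂ (proj₂ (proj₂ ham))))

    adjacent-pred : ∀ k → E H (c (k - + 1)) (c k)
    adjacent-pred k = subst (λ j → E H (c (k - + 1)) (c j)) (pred+1 k) (adjacent (k - + 1))
      where
      pred+1 : ∀ k → (k - + 1) + + 1 ≡ k
      pred+1 = solve-∀

    c-residue : ∀ k → c k ≡ c (+ (k %ℕ suc ℓ))
    c-residue k = trans (cong c (a≡a%ℕn+[a/ℕn]*n k (suc ℓ))) (periodic-multiple c periodic _ (k /ℕ suc ℓ))

    congruent : ∀ {a b} → c a ≡ c b → ∃[ q ] a ≡ b + q * + suc ℓ
    congruent {a} {b} ca≡cb = qa - qb , (begin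
      a                                          ≡⟨ a≡a%ℕn+[a/ℕn]*n a (suc ℓ) ⟩
      + ra + qa * + suc ℓ                        ≡⟨ cong (λ r → + r + qa * + suc ℓ) ra≡rb ⟩
      + rb + qa * + suc ℓ                        ≡⟨ regroup (+ rb) qa qb (+ suc ℓ) ⟩
      (+ rb + qb * + suc ℓ) + (qa - qb) * + suc ℓ ≡⟨ cong (_+ (qa - qb) * + suc ℓ) (sym (a≡a%ℕn+[a/ℕn]*n b (suc ℓ))) ⟩
      b + (qa - qb) * + suc ℓ                    ∎)
      where
      open ≡-Reasoning
      ra rb : ℕ
      ra = a %ℕ suc ℓ
      rb = b %ℕ suc ℓ
      qa qb : ℤ
      qa = a /ℕ suc ℓ
      qb = b /ℕ suc ℓ
      ra≡rb : ra ≡ rb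
      ra≡rb = +-injective (injective-on-period (+ ra) (+ rb) (+≤+ z≤n) (+<+ (n%ℕd<d a (suc ℓ)))
                (+≤+ z≤n) (+<+ (n%ℕd<d b (suc ℓ))) (trans (sym (c-residue a)) (trans ca≡cb (c-residue b))))
      regroup : ∀ r qa qb m → r + qa * m ≡ (r + qb * m) + (qa - qb) * m
      regroup = solve-∀

    reflect : HamCycleMinus H v (suc ℓ) (λ k → c (- k))
    reflect = three≤length , periodic⁻ , injective⁻ , (λ k → avoids (- k)) , covers⁻ , adjacent⁻
      where
      periodic⁻ : ∀ k → c (- (k + + suc ℓ)) ≡ c (- k)
      periodic⁻ k = trans (sym (periodic _)) (cong c (cancel k (+ suc ℓ)))
        where
        cancel : ∀ k m → - (k + m) + m ≡ - k
        cancel = solve-∀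

      injective⁻ : ∀ a b → + 0 ℤ.≤ a → a ℤ.< + suc ℓ → + 0 ℤ.≤ b → b ℤ.< + suc ℓ → c (- a) ≡ c (- b) → a ≡ b
      injective⁻ (+ a) (+ b) _ (+<+ a<length) _ (+<+ b<length) eq with congruent eq
      ... | q , -a≡-b+qm = cong +_ (residue-unique (- q) a<length b<length (negate (+ a) (+ b) q -a≡-b+qm))
        where
        negate : ∀ a b q → - a ≡ - b + q * + suc ℓ → a ≡ b + (- q) * + suc ℓ
        negate a b q eq = trans (sym (neg-involutive a)) (trans (cong -_ eq) (flip b q (+ suc ℓ)))
          where
          flip : ∀ b q m → - (- b + q * m) ≡ b + (- q) * m
          flip = solve-∀

      covers⁻ : ∀ u → u ≢ v → ∃[ k ] c (- k) ≡ u
      covers⁻ u u≢v with covers u u≢v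
      ... | k , ck≡u = - k , trans (cong c (neg-involutive k)) ck≡u

      adjacent⁻ : ∀ k → E H (c (- k)) (c (- (k + + 1)))
      adjacent⁻ k = subst (λ j → E H (c (- k)) (c j)) (pred≡ k) (E-sym H (adjacent-pred (- k)))
        where
        pred≡ : ∀ k → - k - + 1 ≡ - (k + + 1)
        pred≡ = solve-∀

    module Walk (i : ℤ) (v~ci : E H v (c i)) where

      vertexAt : ℕ → Fin (n H)
      vertexAt zero = v
      vertexAt (suc t) = c (i + + t)

      position : ∀ k → ∃₂ λ r q → r < suc ℓ × k ≡ (i + + r) + q * + suc ℓ
      position k = r , q , n%ℕd<d (k - i) (suc ℓ) , (begin
        k                       ≡⟨ split i k ⟩
        i + (k - i)             ≡⟨ cong (λ d → i + d) (a≡a%ℕn+[a/ℕn]*n (k - i) (suc ℓ)) ⟩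
        i + (+ r + q * + suc ℓ) ≡⟨ sym (+-assoc i (+ r) _) ⟩
        (i + + r) + q * + suc ℓ ∎)
        where
        open ≡-Reasoning
        r : ℕ
        r = (k - i) %ℕ suc ℓ
        q : ℤ
        q = (k - i) /ℕ suc ℓ
        split : ∀ i k → k ≡ i + (k - i)
        split = solve-∀

      at-position : ∀ {k r} q → k ≡ (i + + r) + q * + suc ℓ → c k ≡ vertexAt (suc r)
      at-position {r = r} q k≡ = trans (cong c k≡) (periodic-multiple c periodic (i + + r) q)

      vertexAt-injective : ∀ {a b} → a ≤ suc ℓ → b ≤ suc ℓ → vertexAt a ≡ vertexAt b → a ≡ b
      vertexAt-injective {zero} {zero} _ _ _ = refl
      vertexAt-injective {zero} {suc b} _ _ eq = ⊥-elim (avoids _ (sym eq))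
      vertexAt-injective {suc a} {zero} _ _ eq = ⊥-elim (avoids _ eq)
      vertexAt-injective {suc a} {suc b} a<length b<length eq with congruent eq
      ... | q , eq′ = cong suc (residue-unique q a<length b<length (cancel-left i eq′))

      vertexAt-surjective : ∀ u → ∃[ a ] (a ≤ suc ℓ × vertexAt a ≡ u)
      vertexAt-surjective u with u ≟ v
      ... | yes refl = zero , z≤n , refl
      ... | no u≢v with covers u u≢v
      ...   | k , ck≡u with position k
      ...     | r , q , r<length , k≡ = suc r , r<length , trans (sym (at-position q k≡)) ck≡u

      enumeration : Enumeration H
      enumeration = record
        { last = suc ℓ
        ; vertexAt = vertexAt
        ; vertexAt-injective = vertexAt-injective
        ; vertexAt-surjective = vertexAt-surjective
        }

      vertexAt-adjacent : ∀ {t} → t < suc ℓ → E H (vertexAt t) (vertexAt (suc t))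
      vertexAt-adjacent {zero} _ = subst (λ j → E H v (c j)) (sym (+-identityʳ i)) v~ci
      vertexAt-adjacent {suc t} _ = subst (λ j → E H (c (i + + t)) (c j)) (shift i (+ t)) (adjacent (i + + t))
        where
        shift : ∀ i t → (i + t) + + 1 ≡ i + (+ 1 + t)
        shift = solve-∀

      vertexAt-last : vertexAt (suc ℓ) ≡ c (i - + 1)
      vertexAt-last = trans (cong c (around i (+ ℓ))) (periodic (i - + 1))
        where
        around : ∀ i l → i + l ≡ (i - + 1) + (+ 1 + l)
        around = solve-∀

      successor≢predecessor : c (i + + 1) ≢ c (i - + 1)
      successor≢predecessor eq =
        <-irrefl (vertexAt-injective (<⇒≤ three≤length) ≤-refl (trans eq (sym vertexAt-last))) three≤length

      -- The cycle edge c (i - 1) c i plays the role of the chord.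
      successor-of-degree-two : Subcubic H → deg H v ≤ 2 → deg H (c (i + + 1)) ≡ 2 → EdgeColorable H 3
      successor-of-degree-two subcubic deg-v deg-succ =
        exchange⇒edgeColorable enumeration subcubic vertexAt-adjacent deg-v (after {x = 0}) three≤length
          chord (≤-reflexive deg-succ)
        where
        chord : E H (vertexAt 1) (vertexAt (suc ℓ))
        chord = subst₂ (E H) (cong c (sym (+-identityʳ i))) (sym vertexAt-last) (E-sym H (adjacent-pred i))

      module ChordAt {l : ℤ} {r : ℕ} (q : ℤ) (r<length : r < suc ℓ) (l≡ : l ≡ (i + + r) + q * + suc ℓ)
                     (pred~l : E H (c (i - + 1)) (c l)) (l≢i-2 : c l ≢ c ((i - + 1) - + 1)) where

        shifted : ∀ d → c (l + d) ≡ c ((i + + r) + d)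
        shifted d = trans (cong c (trans (cong (_+ d) l≡) (swap (i + + r) (q * + suc ℓ) d)))
                          (periodic-multiple c periodic _ q)
          where
          swap : ∀ a b d → (a + b) + d ≡ (a + d) + b
          swap = solve-∀

        x~last : E H (vertexAt (suc r)) (vertexAt (suc ℓ))
        x~last = subst₂ (E H) (at-position q l≡) (sym vertexAt-last) (E-sym H pred~l)

        r≢ℓ : r ≢ ℓ
        r≢ℓ refl = E-irrefl H (subst (E H _) (trans (at-position q l≡) vertexAt-last) pred~l)

        r+1≢ℓ : suc r ≢ ℓ
        r+1≢ℓ refl = l≢i-2 (trans (at-position q l≡) (trans (cong c (back i (+ r))) (periodic _)))
          where
          back : ∀ i r → i + r ≡ ((i - + 1) - + 1) + (+ 1 + (+ 1 + r))
          back = solve-∀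

        x+1<last : suc (suc r) < suc ℓ
        x+1<last = s≤s (≤∧≢⇒< (≤∧≢⇒< (≤-pred r<length) r≢ℓ) r+1≢ℓ)

        chord-after : Subcubic H → deg H v ≤ 2 → deg H (c (l + + 1)) ≡ 2 → EdgeColorable H 3
        chord-after subcubic deg-v deg-l+1 =
          exchange⇒edgeColorable enumeration subcubic vertexAt-adjacent deg-v after x+1<last x~last
            (≤-reflexive (trans (cong (deg H) (sym (trans (shifted (+ 1)) (cong c (assoc i (+ r)))))) deg-l+1))
          where
          assoc : ∀ i r → (i + r) + + 1 ≡ i + (+ 1 + r)
          assoc = solve-∀

        even-offset : 2 ∣ suc ℓ → 2 ∣ ∣ i - l ∣ → 2 ∣ r
        even-offset 2∣length 2∣i-l =
          ∣⇒∣ᵤ (∣m+n∣n⇒∣m {m = + r} 2∣r+qm (∣n⇒∣m*n q {n = + suc ℓ} (∣ᵤ⇒∣ 2∣length)))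
          where
          negate : ∀ i r qm → - (i - ((i + r) + qm)) ≡ r + qm
          negate = solve-∀
          2∣r+qm : + 2 Signed.∣ (+ r + q * + suc ℓ)
          2∣r+qm = subst (λ d → + 2 Signed.∣ d) (trans (cong (λ l → - (i - l)) l≡) (negate i (+ r) _))
                     (∣m⇒∣-m (∣ᵤ⇒∣ 2∣i-l))

        chord-before : Subcubic H → deg H v ≤ 2 → 2 ∣ suc ℓ → c l ≢ c ((i - + 1) + + 1) →
                       deg H (c (l - + 1)) ≡ 2 → 2 ∣ ∣ i - l ∣ → EdgeColorable H 3
        chord-before subcubic deg-v 2∣length l≢i deg-l-1 2∣i-l =
          exchange⇒edgeColorable enumeration subcubic vertexAt-adjacent deg-v (before r≢0 even-cycle)
            x+1<last x~last (≤-reflexive (trans (cong (deg H) (trans (vertexAt-pred r≢0) (sym (shifted _)))) deg-l-1))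
          where
          r≢0 : r ≢ 0
          r≢0 refl = l≢i (trans (at-position q l≡) (cong c (back i)))
            where
            back : ∀ i → i + + 0 ≡ (i - + 1) + + 1
            back = solve-∀
          vertexAt-pred : ∀ {r} → r ≢ 0 → vertexAt r ≡ c ((i + + r) - + 1)
          vertexAt-pred {zero} r≢0 = ⊥-elim (r≢0 refl)
          vertexAt-pred {suc r} _ = cong c (back i (+ r))
            where
            back : ∀ i r → i + r ≡ (i + (+ 1 + r)) - + 1
            back = solve-∀
          even-cycle : 2 ∣ (suc ℓ ∸ r)
          even-cycle = ∣m+n∣m⇒∣n (subst (2 ∣_) (sym (m+[n∸m]≡n (<⇒≤ r<length))) 2∣length) (even-offset 2∣length 2∣i-l)

      chord-from-predecessor :
        Subcubic H → deg H v ≤ 2 → 2 ∣ suc ℓ → ∀ l → Chord H c (i - + 1) l →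
        deg H (c (l + + 1)) ≡ 2 ⊎ (deg H (c (l - + 1)) ≡ 2 × 2 ∣ ∣ i - l ∣) → EdgeColorable H 3
      chord-from-predecessor subcubic deg-v 2∣length l (pred~l , l≢i , l≢i-2) degrees with position l
      ... | r , q , r<length , l≡ with degrees
      ...   | inj₁ deg-l+1 = ChordAt.chord-after q r<length l≡ pred~l l≢i-2 subcubic deg-v deg-l+1
      ...   | inj₂ (deg-l-1 , 2∣i-l) =
        ChordAt.chord-before q r<length l≡ pred~l l≢i-2 subcubic deg-v 2∣length l≢i deg-l-1 2∣i-l

  module AtNeighbour (H : Graph) {v : Fin (n H)} {ℓ : ℕ} (c : ℤ → Fin (n H))
                     (ham : HamCycleMinus H v (suc ℓ) c) {i : ℤ} (v~ci : E H v (c i)) where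

    private
      c⁻ : ℤ → Fin (n H)
      c⁻ k = c (- k)

      v~c⁻i : E H v (c⁻ (- i))
      v~c⁻i = subst (λ k → E H v (c k)) (sym (neg-involutive i)) v~ci

    open HamCycle H c ham using (avoids; adjacent; adjacent-pred; reflect)
    module Forward = HamCycle.Walk H c ham i v~ci
    module Backward = HamCycle.Walk H c⁻ reflect (- i) v~c⁻i

    edgeColorable⇒3≤ : ∀ {k} → EdgeColorable H k → 3 ≤ k
    edgeColorable⇒3≤ colourable = length≤colours H colourable
      ((avoids _ ∘ sym ∷ avoids _ ∘ sym ∷ []) ∷ (Forward.successor≢predecessor ∷ []) ∷ [] ∷ [])
      (E-sym H v~ci ∷ adjacent i ∷ E-sym H (adjacent-pred i) ∷ [])

    neighbour-of-degree-two : Subcubic H → deg H v ≤ 2 →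
      deg H (c (i - + 1)) ≡ 2 ⊎ deg H (c (i + + 1)) ≡ 2 → EdgeColorable H 3
    neighbour-of-degree-two subcubic deg-v (inj₁ deg-pred) =
      Backward.successor-of-degree-two subcubic deg-v (trans (cong (λ k → deg H (c k)) (mirror i)) deg-pred)
      where
      mirror : ∀ i → - (- i + + 1) ≡ i - + 1
      mirror = solve-∀
    neighbour-of-degree-two subcubic deg-v (inj₂ deg-succ) = Forward.successor-of-degree-two subcubic deg-v deg-succ

    reflect-chord : ∀ {l} → Chord H c (i + + 1) l → Chord H c⁻ (- i - + 1) (- l)
    reflect-chord {l} (succ~l , l≢i+2 , l≢i) =
      subst₂ (E H) (cong c (sym (mirror-succ i))) (cong c (sym (neg-involutive l))) succ~l ,
      (λ eq → l≢i (trans (cong c (sym (neg-involutive l))) (trans eq (cong c (mirror-pred i))))) ,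
      (λ eq → l≢i+2 (trans (cong c (sym (neg-involutive l))) (trans eq (cong c (mirror-succ2 i)))))
      where
      mirror-succ : ∀ i → - (- i - + 1) ≡ i + + 1
      mirror-succ = solve-∀
      mirror-pred : ∀ i → - ((- i - + 1) + + 1) ≡ (i + + 1) - + 1
      mirror-pred = solve-∀
      mirror-succ2 : ∀ i → - ((- i - + 1) - + 1) ≡ (i + + 1) + + 1
      mirror-succ2 = solve-∀

    reflect-degrees : ∀ {l} → deg H (c (l - + 1)) ≡ 2 ⊎ (deg H (c (l + + 1)) ≡ 2 × 2 ∣ ∣ i - l ∣) →
      deg H (c⁻ (- l + + 1)) ≡ 2 ⊎ (deg H (c⁻ (- l - + 1)) ≡ 2 × 2 ∣ ∣ - i - - l ∣)
    reflect-degrees {l} (inj₁ deg-pred) = inj₁ (trans (cong (λ k → deg H (c k)) (mirror-pred l)) deg-pred)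
      where
      mirror-pred : ∀ l → - (- l + + 1) ≡ l - + 1
      mirror-pred = solve-∀
    reflect-degrees {l} (inj₂ (deg-succ , 2∣i-l)) =
      inj₂ (trans (cong (λ k → deg H (c k)) (mirror-succ l)) deg-succ ,
            subst (2 ∣_) (sym (trans (cong ∣_∣ (mirror-diff i l)) (∣-i∣≡∣i∣ (i - l)))) 2∣i-l)
      where
      mirror-succ : ∀ l → - (- l - + 1) ≡ l + + 1
      mirror-succ = solve-∀
      mirror-diff : ∀ i l → - i - - l ≡ - (i - l)
      mirror-diff = solve-∀

    chord-colourable :
      Subcubic H → deg H v ≤ 2 → 2 ∣ suc ℓ →
      (∃[ l ] (Chord H c (i - + 1) l × (deg H (c (l + + 1)) ≡ 2 ⊎ (deg H (c (l - + 1)) ≡ 2 × 2 ∣ ∣ i - l ∣))))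
      ⊎ (∃[ l ] (Chord H c (i + + 1) l × (deg H (c (l - + 1)) ≡ 2 ⊎ (deg H (c (l + + 1)) ≡ 2 × 2 ∣ ∣ i - l ∣)))) →
      EdgeColorable H 3
    chord-colourable subcubic deg-v 2∣length (inj₁ (l , chord , degrees)) =
      Forward.chord-from-predecessor subcubic deg-v 2∣length l chord degrees
    chord-colourable subcubic deg-v 2∣length (inj₂ (l , chord , degrees)) =
      Backward.chord-from-predecessor subcubic deg-v 2∣length (- l) (reflect-chord chord) (reflect-degrees degrees)

open import Defs
open import Data.Nat using (ℕ; _≤_; _*_)
open import Data.Fin using (Fin)
open import Data.Integer using (ℤ; +_; _-_; _+_; ∣_∣; _<_) renaming (_≤_ to _≤ℤ_)
open import Data.Integer.Divisibility using (_∣_)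
open import Data.Product using (_×_; ∃-syntax)
open import Data.Sum using (_⊎_)
open import Relation.Binary.PropositionalEquality using (_≡_)
open import Data.Nat using (suc)
import Data.Nat.Divisibility as ℕ
open import Data.Nat.Properties using (≤-reflexive; *-comm; <⇒≱)
open import Data.Product using (_,_)
open import Data.Sum using ([_,_]′; assocˡ; map₁)
open HamiltonianCycle using (module AtNeighbour)

lemma2 : (H : Graph) → Connected H → Subcubic H → TriangleFree H →
    (v : Fin (n H)) → deg H v ≡ 2 →
    (p : ℕ) → (c : ℤ → Fin (n H)) → HamCycleMinus H v (2 * p) c →
    (i j : ℤ) → + 0 ≤ℤ i → i < + (2 * p) → + 0 ≤ℤ j → j < + (2 * p) →
    2 ≤ ∣ i - j ∣ → E H v (c i) → E H v (c j) →
    ((deg H (c (i - + 1)) ≡ 2 ⊎ deg H (c (i + + 1)) ≡ 2 ⊎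
      deg H (c (j - + 1)) ≡ 2 ⊎ deg H (c (j + + 1)) ≡ 2)
     ⊎ (∃[ l ] (Chord H c (i - + 1) l ×
          (deg H (c (l + + 1)) ≡ 2 ⊎ (deg H (c (l - + 1)) ≡ 2 × + 2 ∣ (i - l)))))
     ⊎ (∃[ l ] (Chord H c (i + + 1) l ×
          (deg H (c (l - + 1)) ≡ 2 ⊎ (deg H (c (l + + 1)) ≡ 2 × + 2 ∣ (i - l)))))) →
    ChromaticIndex H 3
lemma2 _ _ _ _ _ _ 0 _ (() , _) _ _ _ _ _ _ _ _ _ _
lemma2 H _ subcubic _ v deg-v (suc p) c ham i j _ _ _ _ _ v~ci v~cj cases =
  [ [ I.neighbour-of-degree-two subcubic deg-v≤2 , J.neighbour-of-degree-two subcubic deg-v≤2 ]′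
  , I.chord-colourable subcubic deg-v≤2 2∣length
  ]′ (map₁ assocˡ cases) ,
  λ k k<3 colourable → <⇒≱ k<3 (I.edgeColorable⇒3≤ colourable)
  where
  module I = AtNeighbour H c ham v~ci
  module J = AtNeighbour H c ham v~cj

  deg-v≤2 : deg H v ≤ 2
  deg-v≤2 = ≤-reflexive deg-v

  2∣length : 2 ℕ.∣ (2 * suc p)
  2∣length = ℕ.divides (suc p) (*-comm 2 (suc p))
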